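{- Let $(G_n)_{n\in\mathbb{N}}$ be an iteratively constructible family of $k$-graphs and let $H$ and $L$ be elementary operations on $k$-graphs. Let $D_0$ be a $k$-graph and define $D_{n+1}=H(L(D_n)\sqcup G_n)$ for $n\in\mathbb{N}$. Then the family $(D_n)_{n\in\mathbb{N}}$ is bi-iteratively constructible.
   Context: A $k$-graph is $G=(V,E;R_1,\ldots,R_k)$ with $(V,E)$ a finite simple graph and labels $R_1,\ldots,R_k\subseteq V$ partitioning $V$; the disjoint union of two $k$-graphs is the disjoint union of the graphs, with label class $R_i$ the union of the two $i$-th label classes. Basic operations on $k$-graphs: $Add_i$ (add a new vertex to $R_i$); $\rho_{i\to j}$ (move all vertices of $R_i$ into $R_j$, leaving $R_i$ empty); $\eta_{i,j}$ (add all edges between vertices labeled $i$ and vertices labeled $j$); $\eta^b_{i,j}$ (equal to $\eta_{i,j}$ if $|R_i\cup R_j|\leq b$, otherwise the identity); $\delta_{i,j}$ (remove all edges between vertices labeled $i$ and $j$). An elementary operation is a finite composition of basic operations. An iteratively constructible family of $k$-graphs satisfies $G_{n+1}=F(G_n)$ for a fixed $k$-graph $G_0$ and elementary operation $F$. A family $(D_n)$ (of labeled or underlying graphs) is bi-iteratively constructible if for some $k'$ there exist a $k'$-graph $D'_0$ and elementary operations $H',F',L'$ on $k'$-graphs with $D'_{n+1}=H'(F'^n(L'(D'_n)))$, such that $D_n$ is obtained from $D'_n$ by ignoring labels (the number of labels $k'$ may differ from $k$). -}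

module Defs where

open import Data.Nat using (ℕ; zero; suc; _+_; _≤ᵇ_)
open import Data.Fin using (Fin; zero; suc; splitAt; _≟_)
open import Data.Bool using (Bool; true; false; _∧_; _∨_; not; if_then_else_)
open import Data.Bool.Properties using (∧-comm; ∨-comm)
open import Data.Sum using (_⊎_; inj₁; inj₂; [_,_]′)
open import Data.Product using (Σ; _,_)
open import Data.List using (List; []; _∷_; map; allFin)
open import Data.Nat.ListAction using (sum)
open import Data.Empty using (⊥-elim)
open import Relation.Nullary using (yes; no)
open import Relation.Nullary.Decidable using (⌊_⌋)
open import Relation.Binary.PropositionalEquality using (_≡_; refl; sym; cong; cong₂)
open import Function.Bundles using (_↔_; Inverse)

-- k-graphs: a finite simple graph on vertex set Fin size (symmetric,
-- irreflexive adjacency) together with a labelling into Fin k; the label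
-- classes R_i = { v | lab v ≡ i } partition the vertex set.

record KGraph (k : ℕ) : Set where
  field
    size    : ℕ
    lab     : Fin size → Fin k
    adj     : Fin size → Fin size → Bool
    adj-sym : ∀ u v → adj u v ≡ adj v u
    adj-irr : ∀ u → adj u u ≡ false

open KGraph public

_==_ : ∀ {m} → Fin m → Fin m → Bool
i == j = ⌊ i ≟ j ⌋

==-sym : ∀ {m} (i j : Fin m) → (i == j) ≡ (j == i)
==-sym i j with i ≟ j | j ≟ i
... | yes _ | yes _ = refl
... | no _  | no _  = refl
... | yes p | no q  = ⊥-elim (q (sym p))
... | no p  | yes q = ⊥-elim (p (sym q))

==-refl : ∀ {m} (i : Fin m) → (i == i) ≡ true
==-refl i with i ≟ i
... | yes _ = refl
... | no p  = ⊥-elim (p refl)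

between : ∀ {n k} → (Fin n → Fin k) → Fin k → Fin k → Fin n → Fin n → Bool
between lab i j u v = (lab u == i ∧ lab v == j) ∨ (lab u == j ∧ lab v == i)

between-sym : ∀ {n k} (lab : Fin n → Fin k) i j u v →
              between lab i j u v ≡ between lab i j v u
between-sym lab i j u v
  rewrite ∧-comm (lab u == i) (lab v == j)
        | ∧-comm (lab u == j) (lab v == i)
  = ∨-comm (lab v == j ∧ lab u == i) (lab v == i ∧ lab u == j)

addV : ∀ {k} → Fin k → KGraph k → KGraph k
addV {k} i G = record { size = suc (size G) ; lab = l ; adj = a ; adj-sym = s ; adj-irr = r }
  where
  l : Fin (suc (size G)) → Fin k
  l zero    = i
  l (suc v) = lab G v
  a : Fin (suc (size G)) → Fin (suc (size G)) → Bool
  a zero    _       = false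
  a (suc u) zero    = false
  a (suc u) (suc v) = adj G u v
  s : ∀ u v → a u v ≡ a v u
  s zero    zero    = refl
  s zero    (suc v) = refl
  s (suc u) zero    = refl
  s (suc u) (suc v) = adj-sym G u v
  r : ∀ u → a u u ≡ false
  r zero    = refl
  r (suc u) = adj-irr G u

relabel : ∀ {k} → Fin k → Fin k → KGraph k → KGraph k
relabel i j G = record
  { size = size G
  ; lab = λ v → if lab G v == i then j else lab G v
  ; adj = adj G ; adj-sym = adj-sym G ; adj-irr = adj-irr G }

addE : ∀ {k} → Fin k → Fin k → KGraph k → KGraph k
addE i j G = record
  { size = size G ; lab = lab G ; adj = a
  ; adj-sym = λ u v → cong₂ _∨_ (adj-sym G u v)
                        (cong₂ _∧_ (cong not (==-sym u v)) (between-sym (lab G) i j u v))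
  ; adj-irr = r }
  where
  a : Fin (size G) → Fin (size G) → Bool
  a u v = adj G u v ∨ (not (u == v) ∧ between (lab G) i j u v)
  r : ∀ u → a u u ≡ false
  r u rewrite adj-irr G u | ==-refl u = refl

countLab : ∀ {k} → Fin k → Fin k → KGraph k → ℕ
countLab i j G =
  sum (map (λ v → if (lab G v == i) ∨ (lab G v == j) then 1 else 0) (allFin (size G)))

addEb : ∀ {k} → ℕ → Fin k → Fin k → KGraph k → KGraph k
addEb b i j G = if countLab i j G ≤ᵇ b then addE i j G else G

delE : ∀ {k} → Fin k → Fin k → KGraph k → KGraph k
delE i j G = record
  { size = size G ; lab = lab G ; adj = a
  ; adj-sym = λ u v → cong₂ _∧_ (adj-sym G u v) (cong not (between-sym (lab G) i j u v))
  ; adj-irr = r }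
  where
  a : Fin (size G) → Fin (size G) → Bool
  a u v = adj G u v ∧ not (between (lab G) i j u v)
  r : ∀ u → a u u ≡ false
  r u rewrite adj-irr G u = refl

data BasicOp (k : ℕ) : Set where
  Add  : Fin k → BasicOp k
  ρ    : Fin k → Fin k → BasicOp k
  η    : Fin k → Fin k → BasicOp k
  ηb   : ℕ → Fin k → Fin k → BasicOp k
  δ    : Fin k → Fin k → BasicOp k

applyB : ∀ {k} → BasicOp k → KGraph k → KGraph k
applyB (Add i)    = addV i
applyB (ρ i j)    = relabel i j
applyB (η i j)    = addE i j
applyB (ηb b i j) = addEb b i j
applyB (δ i j)    = delE i j

Elementary : ℕ → Set
Elementary k = List (BasicOp k)

applyE : ∀ {k} → Elementary k → KGraph k → KGraph k
applyE []       G = G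
applyE (o ∷ os) G = applyE os (applyB o G)

iterE : ∀ {k} → ℕ → Elementary k → KGraph k → KGraph k
iterE zero    F G = G
iterE (suc n) F G = applyE F (iterE n F G)

adjSum : ∀ {n m} → (Fin n → Fin n → Bool) → (Fin m → Fin m → Bool) →
         Fin n ⊎ Fin m → Fin n ⊎ Fin m → Bool
adjSum a b (inj₁ x) (inj₁ y) = a x y
adjSum a b (inj₂ x) (inj₂ y) = b x y
adjSum a b (inj₁ _) (inj₂ _) = false
adjSum a b (inj₂ _) (inj₁ _) = false

adjSum-sym : ∀ {n m} (a : Fin n → Fin n → Bool) (b : Fin m → Fin m → Bool) →
             (∀ x y → a x y ≡ a y x) → (∀ x y → b x y ≡ b y x) →
             ∀ p q → adjSum a b p q ≡ adjSum a b q p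
adjSum-sym a b sa sb (inj₁ x) (inj₁ y) = sa x y
adjSum-sym a b sa sb (inj₂ x) (inj₂ y) = sb x y
adjSum-sym a b sa sb (inj₁ _) (inj₂ _) = refl
adjSum-sym a b sa sb (inj₂ _) (inj₁ _) = refl

adjSum-irr : ∀ {n m} (a : Fin n → Fin n → Bool) (b : Fin m → Fin m → Bool) →
             (∀ x → a x x ≡ false) → (∀ x → b x x ≡ false) →
             ∀ p → adjSum a b p p ≡ false
adjSum-irr a b ra rb (inj₁ x) = ra x
adjSum-irr a b ra rb (inj₂ x) = rb x

_⊔_ : ∀ {k} → KGraph k → KGraph k → KGraph k
G ⊔ G' = record
  { size = size G + size G'
  ; lab = λ v → [ lab G , lab G' ]′ (splitAt (size G) v)
  ; adj = λ u v → adjSum (adj G) (adj G') (splitAt (size G) u) (splitAt (size G) v)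
  ; adj-sym = λ u v → adjSum-sym (adj G) (adj G') (adj-sym G) (adj-sym G')
                        (splitAt (size G) u) (splitAt (size G) v)
  ; adj-irr = λ u → adjSum-irr (adj G) (adj G') (adj-irr G) (adj-irr G') (splitAt (size G) u) }

UnderlyingIso : ∀ {k k'} → KGraph k → KGraph k' → Set
UnderlyingIso G G' =
  Σ (Fin (size G) ↔ Fin (size G')) λ f →
    ∀ u v → adj G u v ≡ adj G' (Inverse.to f u) (Inverse.to f v)

IterativelyConstructible : ∀ {k} → (ℕ → KGraph k) → Set
IterativelyConstructible {k} G =
  Σ (Elementary k) λ F → ∀ n → G (suc n) ≡ applyE F (G n)

biSeq : ∀ {k} → KGraph k → (H F L : Elementary k) → ℕ → KGraph k
biSeq D0 H F L zero    = D0
biSeq D0 H F L (suc n) = applyE H (iterE n F (applyE L (biSeq D0 H F L n)))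

BiIterativelyConstructible : ∀ {k} → (ℕ → KGraph k) → Set
BiIterativelyConstructible D =
  Σ ℕ λ k' → Σ (KGraph k') λ D0' → Σ (Elementary k') λ H' →
  Σ (Elementary k') λ F' → Σ (Elementary k') λ L' →
    ∀ n → UnderlyingIso (D n) (biSeq D0' H' F' L' n)

DSeq : ∀ {k} → (ℕ → KGraph k) → (H L : Elementary k) → KGraph k → ℕ → KGraph k
DSeq G H L D0 zero    = D0
DSeq G H L D0 (suc n) = applyE H (applyE L (DSeq G H L D0 n) ⊔ G n)

-- D'_n simulates D_n over three disjoint copies of the labels: a copy of [k] carrying D_n,
-- a copy of [k] carrying the current member of the iterated family, and one tag per vertex
-- of G_0.  L' runs L on the first copy, builds G_0 from scratch with the tags (every graph
-- is constructible once each vertex has its own label), and moves it to the second copy;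
-- F'^n runs F on the second copy and so turns G_0 into G_n; H' merges the second copy into
-- the first and runs H.  Operations on one copy never touch vertices labelled in another,
-- so D_n stays isomorphic to the part of D'_n carried by the first copy, which is all of it.
module Submission where

open import Defs
open import Data.Nat.Properties using (+-assoc; +-identityʳ; +-0-commutativeMonoid)
open import Algebra.Properties.CommutativeMonoid.Sum +-0-commutativeMonoid
  using (sum-syntax; ∑-permute; sum-cong-≗; sum-replicate-zero)
open import Data.Bool using (Bool; true; false; _∧_; _∨_; not; if_then_else_)
open import Data.Bool.Properties using (∧-comm; ∧-zeroʳ; ∧-identityʳ; ∨-comm; ∨-identityʳ; ∨-zeroʳ; ∨-idem)
open import Data.Bool.Solver using (module ∨-∧-Solver)
open import Data.Fin using (Fin; zero; suc; splitAt; _↑ˡ_; _↑ʳ_)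
open import Data.Fin.Properties using (_≟_; suc-injective; ↑ˡ-injective; ↑ʳ-injective; +↔⊎)
open import Data.List using ([]; _∷_; _++_; map; concat; tabulate)
open import Data.Nat using (ℕ; zero; suc; _+_; _≤ᵇ_)
open import Data.Nat.ListAction using () renaming (sum to sumᴸ)
open import Data.Product using (_,_)
open import Data.Sum using (_⊎_; inj₁; inj₂; [_,_]′; map₁)
open import Data.Sum.Properties using (inj₁-injective)
open import Data.Sum.Algebra using (⊎-comm; ⊎-assoc)
open import Data.Sum.Function.Propositional using (_⊎-↔_)
open import Function using (_∘_; id)
open import Function.Bundles using (_↔_; Inverse; Injection; mk↔ₛ′)
open import Function.Construct.Composition using (_↔-∘_)
open import Function.Construct.Identity using (↔-id)
open import Function.Construct.Symmetry using (↔-sym)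
open import Function.Definitions using (Injective)
open import Function.Properties.Inverse using (↔⇒↣)
open import Level using (0ℓ)
open import Relation.Binary.PropositionalEquality
  using (_≡_; _≢_; refl; sym; trans; cong; cong₂; subst; module ≡-Reasoning)
open import Relation.Nullary using (yes; no; contradiction)

open Inverse using (to)

private
  variable
    k k' k₁ k₂ m n : ℕ

≢⇒==-false : {a b : Fin m} → a ≢ b → (a == b) ≡ false
≢⇒==-false {a = a} {b} a≢b with a ≟ b
... | yes a≡b = contradiction a≡b a≢b
... | no _    = refl

injective⇒==-reflects : {f : Fin m → Fin n} → Injective _≡_ _≡_ f →
                         ∀ a b → (f a == f b) ≡ (a == b)
injective⇒==-reflects {f = f} f-inj a b with a ≟ b
... | yes refl = ==-refl (f a)
... | no a≢b   = ≢⇒==-false (a≢b ∘ f-inj)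

↑ˡ≢↑ʳ : (i : Fin m) (j : Fin n) → i ↑ˡ n ≢ m ↑ʳ j
↑ˡ≢↑ʳ zero    j ()
↑ˡ≢↑ʳ (suc i) j eq = ↑ˡ≢↑ʳ i j (suc-injective eq)

between-injective : {f : Fin k → Fin k'} → Injective _≡_ _≡_ f → ∀ i j a b →
                    between id (f i) (f j) (f a) (f b) ≡ between id i j a b
between-injective f-inj i j a b
  rewrite injective⇒==-reflects f-inj a i | injective⇒==-reflects f-inj b j
        | injective⇒==-reflects f-inj a j | injective⇒==-reflects f-inj b i = refl

between-missˡ : ∀ (i j a b : Fin k) → a ≢ i → a ≢ j → between id i j a b ≡ false
between-missˡ i j a b a≢i a≢j rewrite ≢⇒==-false a≢i | ≢⇒==-false a≢j = refl

between-missʳ : ∀ (i j a b : Fin k) → b ≢ i → b ≢ j → between id i j a b ≡ false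
between-missʳ i j a b b≢i b≢j = trans (between-sym id i j a b) (between-missˡ i j b a b≢i b≢j)

adj≡not==∧adj : (G : KGraph k) (u v : Fin (size G)) → adj G u v ≡ not (u == v) ∧ adj G u v
adj≡not==∧adj G u v with u ≟ v
... | yes refl = adj-irr G u
... | no _     = refl

∅ : KGraph k
∅ = record { size = 0 ; lab = λ () ; adj = λ () ; adj-sym = λ () ; adj-irr = λ () }

mapLab : (Fin k → Fin k') → KGraph k → KGraph k'
mapLab g X = record { size = size X ; lab = g ∘ lab X
                    ; adj = adj X ; adj-sym = adj-sym X ; adj-irr = adj-irr X }

record LabelIso (g : Fin k → Fin k') (X : KGraph k) (Y : KGraph k') : Set where
  field
    iso    : Fin (size X) ↔ Fin (size Y)
    adj-to : ∀ u v → adj X u v ≡ adj Y (to iso u) (to iso v)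
    lab-to : ∀ u → lab Y (to iso u) ≡ g (lab X u)

record UnionIso (l₁ : Fin k₁ → Fin k) (l₂ : Fin k₂ → Fin k)
                (X : KGraph k₁) (Z : KGraph k₂) (Y : KGraph k) : Set where
  field
    iso     : (Fin (size X) ⊎ Fin (size Z)) ↔ Fin (size Y)
    adj-to  : ∀ p q → adjSum (adj X) (adj Z) p q ≡ adj Y (to iso p) (to iso q)
    lab-to₁ : ∀ a → lab Y (to iso (inj₁ a)) ≡ l₁ (lab X a)
    lab-to₂ : ∀ c → lab Y (to iso (inj₂ c)) ≡ l₂ (lab Z c)

open LabelIso
open UnionIso

LabelIso⇒UnderlyingIso : {g : Fin k → Fin k'} {X : KGraph k} {Y : KGraph k'} →
                         LabelIso g X Y → UnderlyingIso X Y
LabelIso⇒UnderlyingIso R = iso R , adj-to R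

mapLab-≅ : (g : Fin k → Fin k') (X : KGraph k) → LabelIso g X (mapLab g X)
mapLab-≅ g X = record { iso = ↔-id _ ; adj-to = λ _ _ → refl ; lab-to = λ _ → refl }

LabelIso-trans : {g : Fin k₁ → Fin k₂} {h : Fin k₂ → Fin k}
                 {X : KGraph k₁} {Y : KGraph k₂} {W : KGraph k} →
                 LabelIso g X Y → LabelIso h Y W → LabelIso (h ∘ g) X W
LabelIso-trans {h = h} R S = record
  { iso    = iso S ↔-∘ iso R
  ; adj-to = λ u v → trans (adj-to R u v) (adj-to S _ _)
  ; lab-to = λ u → trans (lab-to S _) (cong h (lab-to R u)) }

⊎-Fin0 : {A : Set} → (A ⊎ Fin 0) ↔ A
⊎-Fin0 = mk↔ₛ′ [ id , (λ ()) ]′ inj₁ (λ _ → refl) λ { (inj₁ _) → refl ; (inj₂ ()) }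

module _ {l₁ : Fin k₁ → Fin k} {X : KGraph k₁} {Y : KGraph k} where

  LabelIso⇒UnionIso-∅ : (l₂ : Fin k₂ → Fin k) → LabelIso l₁ X Y → UnionIso l₁ l₂ X ∅ Y
  LabelIso⇒UnionIso-∅ l₂ R = record
    { iso     = iso R ↔-∘ ⊎-Fin0
    ; adj-to  = λ { (inj₁ a) (inj₁ b) → adj-to R a b ; (inj₁ a) (inj₂ ()) ; (inj₂ ()) _ }
    ; lab-to₁ = lab-to R
    ; lab-to₂ = λ () }

  UnionIso-∅⇒LabelIso : {l₂ : Fin k₂ → Fin k} → UnionIso l₁ l₂ X ∅ Y → LabelIso l₁ X Y
  UnionIso-∅⇒LabelIso R = record
    { iso    = iso R ↔-∘ ↔-sym ⊎-Fin0
    ; adj-to = λ a b → adj-to R (inj₁ a) (inj₁ b)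
    ; lab-to = lab-to₁ R }

module _ {l₁ : Fin k₁ → Fin k} {l₂ : Fin k₂ → Fin k}
         {X : KGraph k₁} {Z : KGraph k₂} {Y : KGraph k} where

  UnionIso-swap : UnionIso l₁ l₂ X Z Y → UnionIso l₂ l₁ Z X Y
  UnionIso-swap R = record
    { iso     = iso R ↔-∘ ⊎-comm _ _
    ; adj-to  = λ { (inj₁ c) (inj₁ d) → adj-to R (inj₂ c) (inj₂ d)
                  ; (inj₁ c) (inj₂ b) → adj-to R (inj₂ c) (inj₁ b)
                  ; (inj₂ a) (inj₁ d) → adj-to R (inj₁ a) (inj₂ d)
                  ; (inj₂ a) (inj₂ b) → adj-to R (inj₁ a) (inj₁ b) }
    ; lab-to₁ = lab-to₂ R
    ; lab-to₂ = lab-to₁ R }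

  UnionIso-cong : {l₁' : Fin k₁ → Fin k} {l₂' : Fin k₂ → Fin k} →
                  (∀ a → l₁ (lab X a) ≡ l₁' (lab X a)) → (∀ c → l₂ (lab Z c) ≡ l₂' (lab Z c)) →
                  UnionIso l₁ l₂ X Z Y → UnionIso l₁' l₂' X Z Y
  UnionIso-cong eq₁ eq₂ R = record
    { iso     = iso R
    ; adj-to  = adj-to R
    ; lab-to₁ = λ a → trans (lab-to₁ R a) (eq₁ a)
    ; lab-to₂ = λ c → trans (lab-to₂ R c) (eq₂ c) }

  UnionIso-∘ˡ : {g : Fin k' → Fin k₁} {X' : KGraph k'} →
                LabelIso g X' X → UnionIso l₁ l₂ X Z Y → UnionIso (l₁ ∘ g) l₂ X' Z Y
  UnionIso-∘ˡ S R = record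
    { iso     = iso R ↔-∘ (iso S ⊎-↔ ↔-id _)
    ; adj-to  = λ { (inj₁ a) (inj₁ b) → trans (adj-to S a b) (adj-to R (inj₁ _) (inj₁ _))
                  ; (inj₁ a) (inj₂ d) → adj-to R (inj₁ _) (inj₂ d)
                  ; (inj₂ c) (inj₁ b) → adj-to R (inj₂ c) (inj₁ _)
                  ; (inj₂ c) (inj₂ d) → adj-to R (inj₂ c) (inj₂ d) }
    ; lab-to₁ = λ a → trans (lab-to₁ R _) (cong l₁ (lab-to S a))
    ; lab-to₂ = lab-to₂ R }

  UnionIso-∘ʳ : {h : Fin k → Fin k'} {Y' : KGraph k'} →
                UnionIso l₁ l₂ X Z Y → LabelIso h Y Y' → UnionIso (h ∘ l₁) (h ∘ l₂) X Z Y'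
  UnionIso-∘ʳ {h = h} R S = record
    { iso     = iso S ↔-∘ iso R
    ; adj-to  = λ p q → trans (adj-to R p q) (adj-to S _ _)
    ; lab-to₁ = λ a → trans (lab-to S _) (cong h (lab-to₁ R a))
    ; lab-to₂ = λ c → trans (lab-to S _) (cong h (lab-to₂ R c)) }

UnionIso⇒LabelIso-⊔ : {l : Fin k₁ → Fin k} {X Z : KGraph k₁} {Y : KGraph k} →
                      UnionIso l l X Z Y → LabelIso l (X ⊔ Z) Y
UnionIso⇒LabelIso-⊔ {l = l} {X} {Z} {Y} R = record
  { iso    = iso R ↔-∘ +↔⊎
  ; adj-to = λ u v → adj-to R _ _
  ; lab-to = lab-split }
  where
  lab-split : ∀ w → lab Y (to (iso R) (splitAt (size X) w)) ≡ l (lab (X ⊔ Z) w)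
  lab-split w with splitAt (size X) w
  ... | inj₁ a = lab-to₁ R a
  ... | inj₂ c = lab-to₂ R c

-- Elementary operations act independently on disjointly labelled parts

mapOp : (Fin k → Fin k') → BasicOp k → BasicOp k'
mapOp l (Add i)    = Add (l i)
mapOp l (ρ i j)    = ρ (l i) (l j)
mapOp l (η i j)    = η (l i) (l j)
mapOp l (ηb b i j) = ηb b (l i) (l j)
mapOp l (δ i j)    = δ (l i) (l j)

mapE : (Fin k → Fin k') → Elementary k → Elementary k'
mapE l = map (mapOp l)

mapOp-id : (o : BasicOp k) → mapOp id o ≡ o
mapOp-id (Add i)    = refl
mapOp-id (ρ i j)    = refl
mapOp-id (η i j)    = refl
mapOp-id (ηb b i j) = refl
mapOp-id (δ i j)    = refl

mapE-id : (ops : Elementary k) → mapE id ops ≡ ops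
mapE-id []        = refl
mapE-id (o ∷ ops) = cong₂ _∷_ (mapOp-id o) (mapE-id ops)

applyE-++ : (ops ops' : Elementary k) (G : KGraph k) →
            applyE (ops ++ ops') G ≡ applyE ops' (applyE ops G)
applyE-++ []        ops' G = refl
applyE-++ (o ∷ ops) ops' G = applyE-++ ops ops' (applyB o G)

indicator : Fin k → Fin k → Fin k → ℕ
indicator i j a = if (a == i) ∨ (a == j) then 1 else 0

sumᴸ-map-tabulate : {A : Set} (h : A → ℕ) (g : Fin n → A) →
                    sumᴸ (map h (tabulate g)) ≡ ∑[ v < n ] h (g v)
sumᴸ-map-tabulate {zero}  h g = refl
sumᴸ-map-tabulate {suc n} h g = cong (h (g zero) +_) (sumᴸ-map-tabulate h (g ∘ suc))

countLab-∑ : (i j : Fin k) (G : KGraph k) → countLab i j G ≡ ∑[ v < size G ] indicator i j (lab G v)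
countLab-∑ i j G = sumᴸ-map-tabulate (λ v → indicator i j (lab G v)) id

∑-splitAt : (f : Fin m ⊎ Fin n → ℕ) →
            ∑[ w < m + n ] f (splitAt m w) ≡ ∑[ a < m ] f (inj₁ a) + ∑[ c < n ] f (inj₂ c)
∑-splitAt {zero}  f = refl
∑-splitAt {suc m} {n} f =
  trans (cong (f (inj₁ zero) +_) (∑-splitAt (f ∘ map₁ suc)))
        (sym (+-assoc (f (inj₁ zero)) (∑[ a < m ] f (inj₁ (suc a))) (∑[ c < n ] f (inj₂ c))))

∨-∧-false : ∀ a n b → b ≡ false → a ≡ a ∨ (n ∧ b)
∨-∧-false a n b refl = sym (trans (cong (a ∨_) (∧-zeroʳ n)) (∨-identityʳ a))

module Simulation {l₁ : Fin k₁ → Fin k} {l₂ : Fin k₂ → Fin k}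
                  {X : KGraph k₁} {Z : KGraph k₂} {Y : KGraph k}
                  (l₁-inj : Injective _≡_ _≡_ l₁) (disjoint : ∀ c a → l₂ (lab Z c) ≢ l₁ a)
                  (R : UnionIso l₁ l₂ X Z Y) where

  private
    τ = to (iso R)

  τ-inj₁-== : ∀ a b → (τ (inj₁ a) == τ (inj₁ b)) ≡ (a == b)
  τ-inj₁-== = injective⇒==-reflects (inj₁-injective ∘ Injection.injective (↔⇒↣ (iso R)))

  countLab-≅ : ∀ i j → countLab (l₁ i) (l₁ j) Y ≡ countLab i j X
  countLab-≅ i j = begin
    countLab (l₁ i) (l₁ j) Y
      ≡⟨ countLab-∑ _ _ Y ⟩
    ∑[ y < size Y ] ind (lab Y y)
      ≡⟨ ∑-permute _ (iso R ↔-∘ +↔⊎) ⟩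
    ∑[ w < size X + size Z ] ind (lab Y (τ (splitAt (size X) w)))
      ≡⟨ ∑-splitAt (ind ∘ lab Y ∘ τ) ⟩
    ∑[ a < size X ] ind (lab Y (τ (inj₁ a))) + ∑[ c < size Z ] ind (lab Y (τ (inj₂ c)))
      ≡⟨ cong₂ _+_ (sum-cong-≗ on-X) (trans (sum-cong-≗ on-Z) (sum-replicate-zero (size Z))) ⟩
    ∑[ a < size X ] indicator i j (lab X a) + 0
      ≡⟨ +-identityʳ _ ⟩
    ∑[ a < size X ] indicator i j (lab X a)
      ≡⟨ countLab-∑ i j X ⟨
    countLab i j X ∎
    where
    open ≡-Reasoning
    ind = indicator (l₁ i) (l₁ j)
    on-X : ∀ a → ind (lab Y (τ (inj₁ a))) ≡ indicator i j (lab X a)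
    on-X a rewrite lab-to₁ R a | injective⇒==-reflects l₁-inj (lab X a) i
                 | injective⇒==-reflects l₁-inj (lab X a) j = refl
    on-Z : ∀ c → ind (lab Y (τ (inj₂ c))) ≡ 0
    on-Z c rewrite lab-to₂ R c | ≢⇒==-false (disjoint c i) | ≢⇒==-false (disjoint c j) = refl

  between-missˡ-to : ∀ i j c q → false ≡ between (lab Y) (l₁ i) (l₁ j) (τ (inj₂ c)) (τ q)
  between-missˡ-to i j c q =
    sym (trans (cong (λ x → between id (l₁ i) (l₁ j) x (lab Y (τ q))) (lab-to₂ R c))
               (between-missˡ (l₁ i) (l₁ j) _ (lab Y (τ q)) (disjoint c i) (disjoint c j)))

  between-to : ∀ i j p q → adjSum (between (lab X) i j) (λ _ _ → false) p q
                           ≡ between (lab Y) (l₁ i) (l₁ j) (τ p) (τ q)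
  between-to i j (inj₁ a) (inj₁ b) =
    sym (trans (cong₂ (between id (l₁ i) (l₁ j)) (lab-to₁ R a) (lab-to₁ R b))
               (between-injective l₁-inj i j (lab X a) (lab X b)))
  between-to i j (inj₁ a) (inj₂ d) =
    sym (trans (cong (between id (l₁ i) (l₁ j) (lab Y (τ (inj₁ a)))) (lab-to₂ R d))
               (between-missʳ (l₁ i) (l₁ j) (lab Y (τ (inj₁ a))) _ (disjoint d i) (disjoint d j)))
  between-to i j (inj₂ c) q@(inj₁ _) = between-missˡ-to i j c q
  between-to i j (inj₂ c) q@(inj₂ _) = between-missˡ-to i j c q

  addV-≅ : ∀ i → UnionIso l₁ l₂ (addV i X) Z (addV (l₁ i) Y)
  addV-≅ i = record
    { iso     = iso′
    ; adj-to  = adj-to′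
    ; lab-to₁ = λ { zero → refl ; (suc a) → lab-to₁ R a }
    ; lab-to₂ = lab-to₂ R }
    where
    iso′ : (Fin (suc (size X)) ⊎ Fin (size Z)) ↔ Fin (suc (size Y))
    -- (1 + x) ⊎ z ≅ 1 ⊎ (x ⊎ z) ≅ 1 ⊎ y ≅ 1 + y: the two new vertices correspond.
    iso′ = ↔-sym +↔⊎ ↔-∘ ((↔-id (Fin 1) ⊎-↔ iso R) ↔-∘ (⊎-assoc 0ℓ _ _ _ ↔-∘ (+↔⊎ ⊎-↔ ↔-id _)))
    adj-to′ : ∀ p q → adjSum (adj (addV i X)) (adj Z) p q
                    ≡ adj (addV (l₁ i) Y) (to iso′ p) (to iso′ q)
    adj-to′ (inj₁ zero)    (inj₁ zero)    = refl
    adj-to′ (inj₁ zero)    (inj₁ (suc b)) = refl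
    adj-to′ (inj₁ zero)    (inj₂ d)       = refl
    adj-to′ (inj₁ (suc a)) (inj₁ zero)    = refl
    adj-to′ (inj₁ (suc a)) (inj₁ (suc b)) = adj-to R (inj₁ a) (inj₁ b)
    adj-to′ (inj₁ (suc a)) (inj₂ d)       = adj-to R (inj₁ a) (inj₂ d)
    adj-to′ (inj₂ c)       (inj₁ zero)    = refl
    adj-to′ (inj₂ c)       (inj₁ (suc b)) = adj-to R (inj₂ c) (inj₁ b)
    adj-to′ (inj₂ c)       (inj₂ d)       = adj-to R (inj₂ c) (inj₂ d)

  relabel-≅ : ∀ i j → UnionIso l₁ l₂ (relabel i j X) Z (relabel (l₁ i) (l₁ j) Y)
  relabel-≅ i j = record
    { iso = iso R ; adj-to = adj-to R ; lab-to₁ = lab-to₁′ ; lab-to₂ = lab-to₂′ }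
    where
    lab-to₁′ : ∀ a → lab (relabel (l₁ i) (l₁ j) Y) (τ (inj₁ a)) ≡ l₁ (lab (relabel i j X) a)
    lab-to₁′ a rewrite lab-to₁ R a | injective⇒==-reflects l₁-inj (lab X a) i with lab X a == i
    ... | true  = refl
    ... | false = refl
    lab-to₂′ : ∀ c → lab (relabel (l₁ i) (l₁ j) Y) (τ (inj₂ c)) ≡ l₂ (lab Z c)
    lab-to₂′ c rewrite lab-to₂ R c | ≢⇒==-false (disjoint c i) = refl

  addE-≅ : ∀ i j → UnionIso l₁ l₂ (addE i j X) Z (addE (l₁ i) (l₁ j) Y)
  addE-≅ i j = record
    { iso = iso R ; adj-to = adj-to′ ; lab-to₁ = lab-to₁ R ; lab-to₂ = lab-to₂ R }
    where
    unchanged : ∀ p q → false ≡ between (lab Y) (l₁ i) (l₁ j) (τ p) (τ q) →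
                adjSum (adj X) (adj Z) p q ≡ adj (addE (l₁ i) (l₁ j) Y) (τ p) (τ q)
    unchanged p q eq = trans (adj-to R p q) (∨-∧-false _ _ _ (sym eq))
    adj-to′ : ∀ p q → adjSum (adj (addE i j X)) (adj Z) p q ≡ adj (addE (l₁ i) (l₁ j) Y) (τ p) (τ q)
    adj-to′ (inj₁ a) (inj₁ b) =
      cong₂ _∨_ (adj-to R (inj₁ a) (inj₁ b))
                (cong₂ _∧_ (cong not (sym (τ-inj₁-== a b))) (between-to i j (inj₁ a) (inj₁ b)))
    adj-to′ p@(inj₁ _) q@(inj₂ _) = unchanged p q (between-to i j p q)
    adj-to′ p@(inj₂ _) q@(inj₁ _) = unchanged p q (between-to i j p q)
    adj-to′ p@(inj₂ _) q@(inj₂ _) = unchanged p q (between-to i j p q)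

  delE-≅ : ∀ i j → UnionIso l₁ l₂ (delE i j X) Z (delE (l₁ i) (l₁ j) Y)
  delE-≅ i j = record
    { iso = iso R ; adj-to = adj-to′ ; lab-to₁ = lab-to₁ R ; lab-to₂ = lab-to₂ R }
    where
    unchanged : ∀ p q → false ≡ between (lab Y) (l₁ i) (l₁ j) (τ p) (τ q) →
                adjSum (adj X) (adj Z) p q ≡ adj (delE (l₁ i) (l₁ j) Y) (τ p) (τ q)
    unchanged p q eq = trans (adj-to R p q)
      (sym (trans (cong (λ b → adj Y (τ p) (τ q) ∧ not b) (sym eq)) (∧-identityʳ _)))
    adj-to′ : ∀ p q → adjSum (adj (delE i j X)) (adj Z) p q ≡ adj (delE (l₁ i) (l₁ j) Y) (τ p) (τ q)
    adj-to′ (inj₁ a) (inj₁ b) =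
      cong₂ _∧_ (adj-to R (inj₁ a) (inj₁ b)) (cong not (between-to i j (inj₁ a) (inj₁ b)))
    adj-to′ p@(inj₁ _) q@(inj₂ _) = unchanged p q (between-to i j p q)
    adj-to′ p@(inj₂ _) q@(inj₁ _) = unchanged p q (between-to i j p q)
    adj-to′ p@(inj₂ _) q@(inj₂ _) = unchanged p q (between-to i j p q)

  addEb-≅ : ∀ b i j → UnionIso l₁ l₂ (addEb b i j X) Z (addEb b (l₁ i) (l₁ j) Y)
  addEb-≅ b i j rewrite countLab-≅ i j with countLab i j X ≤ᵇ b
  ... | true  = addE-≅ i j
  ... | false = R

  applyB-mapOp : ∀ o → UnionIso l₁ l₂ (applyB o X) Z (applyB (mapOp l₁ o) Y)
  applyB-mapOp (Add i)    = addV-≅ i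
  applyB-mapOp (ρ i j)    = relabel-≅ i j
  applyB-mapOp (η i j)    = addE-≅ i j
  applyB-mapOp (ηb b i j) = addEb-≅ b i j
  applyB-mapOp (δ i j)    = delE-≅ i j

module _ {l₁ : Fin k₁ → Fin k} {l₂ : Fin k₂ → Fin k} {Z : KGraph k₂}
         (l₁-inj : Injective _≡_ _≡_ l₁) (disjoint : ∀ c a → l₂ (lab Z c) ≢ l₁ a) where

  UnionIso-applyE : ∀ ops {X Y} → UnionIso l₁ l₂ X Z Y →
                    UnionIso l₁ l₂ (applyE ops X) Z (applyE (mapE l₁ ops) Y)
  UnionIso-applyE []        R = R
  UnionIso-applyE (o ∷ ops) R = UnionIso-applyE ops (Simulation.applyB-mapOp l₁-inj disjoint R o)

  UnionIso-iterE : ∀ n F {X Y} → UnionIso l₁ l₂ X Z Y →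
                   UnionIso l₁ l₂ (iterE n F X) Z (iterE n (mapE l₁ F) Y)
  UnionIso-iterE zero    F R = R
  UnionIso-iterE (suc n) F R = UnionIso-applyE F (UnionIso-iterE n F R)

LabelIso-applyE : {l : Fin k → Fin k'} {X : KGraph k} {Y : KGraph k'} → Injective _≡_ _≡_ l →
                  ∀ ops → LabelIso l X Y → LabelIso l (applyE ops X) (applyE (mapE l ops) Y)
LabelIso-applyE {l = l} l-inj ops R =
  UnionIso-∅⇒LabelIso (UnionIso-applyE l-inj (λ ()) ops (LabelIso⇒UnionIso-∅ l R))

LabelIso-id-applyE : {X Y : KGraph k} → ∀ ops → LabelIso id X Y → LabelIso id (applyE ops X) (applyE ops Y)
LabelIso-id-applyE {X = X} {Y} ops R =
  subst (λ ops′ → LabelIso id (applyE ops X) (applyE ops′ Y)) (mapE-id ops) (LabelIso-applyE id ops R)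

ρLab : Fin k → Fin k → Fin k → Fin k
ρLab i j a = if a == i then j else a

ρLab-≅ : (i j : Fin k) (Y : KGraph k) → LabelIso (ρLab i j) Y (relabel i j Y)
ρLab-≅ i j Y = record { iso = ↔-id _ ; adj-to = λ _ _ → refl ; lab-to = λ _ → refl }

relabels : (src tgt : Fin n → Fin k) → Elementary k
relabels src tgt = tabulate (λ c → ρ (src c) (tgt c))

relabelsLab : (src tgt : Fin n → Fin k) → Fin k → Fin k
relabelsLab {zero}  src tgt a = a
relabelsLab {suc n} src tgt a = relabelsLab (src ∘ suc) (tgt ∘ suc) (ρLab (src zero) (tgt zero) a)

relabels-≅ : (src tgt : Fin n → Fin k) (Y : KGraph k) →
             LabelIso (relabelsLab src tgt) Y (applyE (relabels src tgt) Y)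
relabels-≅ {zero}  src tgt Y = record { iso = ↔-id _ ; adj-to = λ _ _ → refl ; lab-to = λ _ → refl }
relabels-≅ {suc n} src tgt Y =
  LabelIso-trans (ρLab-≅ (src zero) (tgt zero) Y)
                 (relabels-≅ (src ∘ suc) (tgt ∘ suc) (relabel (src zero) (tgt zero) Y))

relabelsLab-miss : (src tgt : Fin n → Fin k) (a : Fin k) → (∀ c → a ≢ src c) → relabelsLab src tgt a ≡ a
relabelsLab-miss {zero}  src tgt a a∉src = refl
relabelsLab-miss {suc n} src tgt a a∉src rewrite ≢⇒==-false (a∉src zero) =
  relabelsLab-miss (src ∘ suc) (tgt ∘ suc) a (a∉src ∘ suc)

relabelsLab-hit : {src tgt : Fin n → Fin k} → Injective _≡_ _≡_ src → (∀ c c' → tgt c ≢ src c') →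
                  ∀ c → relabelsLab src tgt (src c) ≡ tgt c
relabelsLab-hit {n = suc n} {src = src} {tgt} src-inj tgt∉src zero rewrite ==-refl (src zero) =
  relabelsLab-miss (src ∘ suc) (tgt ∘ suc) (tgt zero) (tgt∉src zero ∘ suc)
relabelsLab-hit {n = suc n} {src = src} {tgt} src-inj tgt∉src (suc c)
  rewrite injective⇒==-reflects src-inj (suc c) zero =
  relabelsLab-hit (suc-injective ∘ src-inj) (λ c c' → tgt∉src (suc c) (suc c')) c

-- Every graph is constructible once each vertex carries its own label

discrete : (m : ℕ) → (Fin m → Fin k) → KGraph k
discrete m f = record
  { size = m ; lab = f ; adj = λ _ _ → false ; adj-sym = λ _ _ → refl ; adj-irr = λ _ → refl }

-- addV inserts at index zero, so the vertex labelled f zero is added last.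
addAll : (m : ℕ) → (Fin m → Fin k) → Elementary k
addAll zero    f = []
addAll (suc m) f = addAll m (f ∘ suc) ++ Add (f zero) ∷ []

addAll-≅ : (m : ℕ) (f : Fin m → Fin k) → LabelIso id (discrete m f) (applyE (addAll m f) ∅)
addAll-≅ zero    f = record { iso = ↔-id _ ; adj-to = λ () ; lab-to = λ () }
addAll-≅ (suc m) f =
  subst (LabelIso id (discrete (suc m) f)) (sym (applyE-++ (addAll m (f ∘ suc)) (Add (f zero) ∷ []) ∅))
        (LabelIso-trans unfold (LabelIso-applyE id (Add (f zero) ∷ []) (addAll-≅ m (f ∘ suc))))
  where
  adj-to′ : ∀ u v → false ≡ adj (addV (f zero) (discrete m (f ∘ suc))) u v
  adj-to′ zero    v       = refl
  adj-to′ (suc u) zero    = refl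
  adj-to′ (suc u) (suc v) = refl
  unfold : LabelIso id (discrete (suc m) f) (addV (f zero) (discrete m (f ∘ suc)))
  unfold = record { iso = ↔-id _ ; adj-to = adj-to′ ; lab-to = λ { zero → refl ; (suc u) → refl } }

⋁ : (Fin n → Bool) → Bool
⋁ {zero}  f = false
⋁ {suc n} f = f zero ∨ ⋁ (f ∘ suc)

⋁-true : (f : Fin n → Bool) (w : Fin n) → f w ≡ true → ⋁ f ≡ true
⋁-true f zero    fw = cong (_∨ ⋁ (f ∘ suc)) fw
⋁-true f (suc w) fw = trans (cong (f zero ∨_) (⋁-true (f ∘ suc) w fw)) (∨-zeroʳ (f zero))

⋁-false : (f : Fin n → Bool) → (∀ w → f w ≡ false) → ⋁ f ≡ false
⋁-false {zero}  f f≡false = refl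
⋁-false {suc n} f f≡false = cong₂ _∨_ (f≡false zero) (⋁-false (f ∘ suc) (f≡false ∘ suc))

withEdges : (W : KGraph k) → (Fin k → Fin k → Bool) → KGraph k
withEdges W e = record
  { size = size W ; lab = lab W ; adj = adj′
  ; adj-sym = λ u v → cong₂ _∨_ (adj-sym W u v)
                                 (cong₂ _∧_ (cong not (==-sym u v)) (∨-comm (e (lab W u) (lab W v)) _))
  ; adj-irr = adj-irr′ }
  where
  adj′ : Fin (size W) → Fin (size W) → Bool
  adj′ u v = adj W u v ∨ (not (u == v) ∧ (e (lab W u) (lab W v) ∨ e (lab W v) (lab W u)))
  adj-irr′ : ∀ u → adj′ u u ≡ false
  adj-irr′ u rewrite adj-irr W u | ==-refl u = refl

Realises : Elementary k → (Fin k → Fin k → Bool) → Set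
Realises ops e = ∀ W → LabelIso id (withEdges W e) (applyE ops W)

realises-[] : Realises {k} [] (λ _ _ → false)
realises-[] W = record
  { iso = ↔-id _ ; adj-to = λ u v → sym (∨-∧-false (adj W u v) _ false refl) ; lab-to = λ _ → refl }

realises-η : (i j : Fin k) → Realises (η i j ∷ []) (λ a b → (a == i) ∧ (b == j))
realises-η i j W = record { iso = ↔-id _ ; adj-to = adj-to′ ; lab-to = λ _ → refl }
  where
  adj-to′ : ∀ u v → adj (withEdges W (λ a b → (a == i) ∧ (b == j))) u v ≡ adj (addE i j W) u v
  adj-to′ u v = cong (λ b → adj W u v ∨ (not (u == v) ∧ ((lab W u == i) ∧ (lab W v == j) ∨ b)))
                     (∧-comm (lab W v == i) (lab W u == j))

realises-if : (b : Bool) (i j : Fin k) →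
              Realises (if b then η i j ∷ [] else []) (λ a c → b ∧ ((a == i) ∧ (c == j)))
realises-if true  i j = realises-η i j
realises-if false i j = realises-[]

realises-++ : {ops₁ ops₂ : Elementary k} {e₁ e₂ : Fin k → Fin k → Bool} →
              Realises ops₁ e₁ → Realises ops₂ e₂ → Realises (ops₁ ++ ops₂) (λ a b → e₁ a b ∨ e₂ a b)
realises-++ {ops₁ = ops₁} {ops₂} {e₁} {e₂} r₁ r₂ W =
  subst (LabelIso id (withEdges W (λ a b → e₁ a b ∨ e₂ a b))) (sym (applyE-++ ops₁ ops₂ W))
        (LabelIso-trans (LabelIso-trans split (r₂ (withEdges W e₁))) (LabelIso-id-applyE ops₂ (r₁ W)))
  where
  open ∨-∧-Solver using (solve; _:+_; _:*_; _:=_)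
  distrib : ∀ a n b c d e → a ∨ (n ∧ ((b ∨ c) ∨ (d ∨ e))) ≡ (a ∨ (n ∧ (b ∨ d))) ∨ (n ∧ (c ∨ e))
  distrib = solve 6 (λ a n b c d e → a :+ n :* ((b :+ c) :+ (d :+ e))
                                   := (a :+ n :* (b :+ d)) :+ n :* (c :+ e)) refl
  split : LabelIso id (withEdges W (λ a b → e₁ a b ∨ e₂ a b)) (withEdges (withEdges W e₁) e₂)
  split = record { iso = ↔-id _ ; adj-to = adj-to′ ; lab-to = λ _ → refl }
    where
    adj-to′ : ∀ u v → adj (withEdges W (λ a b → e₁ a b ∨ e₂ a b)) u v
                    ≡ adj (withEdges (withEdges W e₁) e₂) u v
    adj-to′ u v = distrib (adj W u v) (not (u == v)) (e₁ (lab W u) (lab W v)) (e₂ (lab W u) (lab W v))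
                                                     (e₁ (lab W v) (lab W u)) (e₂ (lab W v) (lab W u))

realises-concat : {f : Fin n → Elementary k} {e : Fin n → Fin k → Fin k → Bool} →
                  (∀ c → Realises (f c) (e c)) → Realises (concat (tabulate f)) (λ a b → ⋁ λ c → e c a b)
realises-concat {zero}  r = realises-[]
realises-concat {suc n} {f = f} r =
  realises-++ {ops₁ = f zero} {ops₂ = concat (tabulate (f ∘ suc))} (r zero) (realises-concat (r ∘ suc))

tagged : (G : KGraph k) → KGraph (size G)
tagged G = record { size = size G ; lab = id ; adj = adj G ; adj-sym = adj-sym G ; adj-irr = adj-irr G }

edgeOps : (G : KGraph k) → Elementary (size G)
edgeOps G = concat (tabulate λ u → concat (tabulate λ v → if adj G u v then η u v ∷ [] else []))

edgeTest : (G : KGraph k) → Fin (size G) → Fin (size G) → Bool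
edgeTest G a b = ⋁ λ u → ⋁ λ v → adj G u v ∧ ((a == u) ∧ (b == v))

edgeOps-realises : (G : KGraph k) → Realises (edgeOps G) (edgeTest G)
edgeOps-realises G = realises-concat λ u → realises-concat λ v → realises-if (adj G u v) u v

edgeTest-adj : (G : KGraph k) (x y : Fin (size G)) → edgeTest G x y ≡ adj G x y
edgeTest-adj G x y with adj G x y in xy
... | true  = ⋁-true _ x (⋁-true _ y hit)
  where
  hit : adj G x y ∧ ((x == x) ∧ (y == y)) ≡ true
  hit rewrite xy | ==-refl x | ==-refl y = refl
... | false = ⋁-false _ λ u → ⋁-false _ λ v → miss u v
  where
  miss : ∀ u v → adj G u v ∧ ((x == u) ∧ (y == v)) ≡ false
  miss u v with x ≟ u | y ≟ v
  ... | yes refl | yes refl = cong (_∧ true) xy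
  ... | no _     | _        = ∧-zeroʳ (adj G u v)
  ... | yes refl | no _     = ∧-zeroʳ (adj G u v)

build : (G : KGraph k) → Elementary (size G)
build G = addAll (size G) id ++ edgeOps G

build-≅ : (G : KGraph k) → LabelIso id (tagged G) (applyE (build G) ∅)
build-≅ G =
  subst (LabelIso id (tagged G)) (sym (applyE-++ (addAll (size G) id) (edgeOps G) ∅))
        (LabelIso-trans (LabelIso-trans tagged-≅ (edgeOps-realises G (discrete (size G) id)))
                        (LabelIso-id-applyE (edgeOps G) (addAll-≅ (size G) id)))
  where
  open ≡-Reasoning
  adj-to′ : ∀ x y → adj G x y ≡ not (x == y) ∧ (edgeTest G x y ∨ edgeTest G y x)
  adj-to′ x y = begin
    adj G x y
      ≡⟨ adj≡not==∧adj G x y ⟩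
    not (x == y) ∧ adj G x y
      ≡⟨ cong (not (x == y) ∧_) (∨-idem (adj G x y)) ⟨
    not (x == y) ∧ (adj G x y ∨ adj G x y)
      ≡⟨ cong (λ b → not (x == y) ∧ (adj G x y ∨ b)) (adj-sym G x y) ⟩
    not (x == y) ∧ (adj G x y ∨ adj G y x)
      ≡⟨ cong₂ (λ b c → not (x == y) ∧ (b ∨ c)) (edgeTest-adj G x y) (edgeTest-adj G y x) ⟨
    not (x == y) ∧ (edgeTest G x y ∨ edgeTest G y x) ∎
  tagged-≅ : LabelIso id (tagged G) (withEdges (discrete (size G) id) (edgeTest G))
  tagged-≅ = record { iso = ↔-id _ ; adj-to = adj-to′ ; lab-to = λ _ → refl }

UnionIso-untag : {l₁ : Fin k₁ → Fin k} {l₂ : Fin k₂ → Fin k}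
                 {W : KGraph k₁} {Z : KGraph k₂} {Y : KGraph k} {t : Fin (size W) → Fin k} →
                 (∀ u → t u ≡ l₁ (lab W u)) → UnionIso t l₂ (tagged W) Z Y → UnionIso l₁ l₂ W Z Y
UnionIso-untag eq R = record
  { iso = iso R ; adj-to = adj-to R ; lab-to₁ = λ u → trans (lab-to₁ R u) (eq u) ; lab-to₂ = lab-to₂ R }

module Construction (G₀ : KGraph k) (F H L : Elementary k) where

  k′ : ℕ
  k′ = k + (k + size G₀)

  inD inG : Fin k → Fin k′
  inD a = a ↑ˡ (k + size G₀)
  inG a = k ↑ʳ (a ↑ˡ size G₀)

  inT : Fin (size G₀) → Fin k′
  inT c = k ↑ʳ (k ↑ʳ c)

  inD-injective : Injective _≡_ _≡_ inD
  inD-injective = ↑ˡ-injective (k + size G₀) _ _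

  inG-injective : Injective _≡_ _≡_ inG
  inG-injective = ↑ˡ-injective (size G₀) _ _ ∘ ↑ʳ-injective k _ _

  inT-injective : Injective _≡_ _≡_ inT
  inT-injective = ↑ʳ-injective k _ _ ∘ ↑ʳ-injective k _ _

  inD≢inG : ∀ a b → inD a ≢ inG b
  inD≢inG a b = ↑ˡ≢↑ʳ a (b ↑ˡ size G₀)

  inD≢inT : ∀ a c → inD a ≢ inT c
  inD≢inT a c = ↑ˡ≢↑ʳ a (k ↑ʳ c)

  inG≢inT : ∀ a c → inG a ≢ inT c
  inG≢inT a c = ↑ˡ≢↑ʳ a c ∘ ↑ʳ-injective k _ _

  L′ F′ H′ : Elementary k′
  L′ = mapE inD L ++ mapE inT (build G₀) ++ relabels inT (inG ∘ lab G₀)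
  F′ = mapE inG F
  H′ = relabels inG inD ++ mapE inD H

  L′-step : {D : KGraph k} {Y : KGraph k′} →
            LabelIso inD D Y → UnionIso inG inD G₀ (applyE L D) (applyE L′ Y)
  L′-step {D} {Y} R = subst (UnionIso inG inD G₀ X) (sym L′-split) moved
    where
    X  = applyE L D
    Y₁ = applyE (mapE inD L) Y
    Y₂ = applyE (mapE inT (build G₀)) Y₁
    Y₃ = applyE (relabels inT (inG ∘ lab G₀)) Y₂
    L′-split : applyE L′ Y ≡ Y₃
    L′-split = trans (applyE-++ (mapE inD L) _ Y) (applyE-++ (mapE inT (build G₀)) _ Y₁)
    afterL : UnionIso inT inD ∅ X Y₁
    afterL = UnionIso-swap (LabelIso⇒UnionIso-∅ inT (LabelIso-applyE inD-injective L R))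
    built : UnionIso inT inD (tagged G₀) X Y₂
    built = UnionIso-∘ˡ (build-≅ G₀)
              (UnionIso-applyE inT-injective (λ a → inD≢inT (lab X a)) (build G₀) afterL)
    moved : UnionIso inG inD G₀ X Y₃
    moved = UnionIso-untag (relabelsLab-hit inT-injective (λ a → inG≢inT (lab G₀ a)))
              (UnionIso-cong (λ _ → refl) (λ a → relabelsLab-miss inT _ (inD (lab X a)) (inD≢inT _))
                (UnionIso-∘ʳ built (relabels-≅ inT (inG ∘ lab G₀) Y₂)))

  F′-steps : ∀ n {X : KGraph k} {Y : KGraph k′} →
             UnionIso inG inD G₀ X Y → UnionIso inG inD (iterE n F G₀) X (iterE n F′ Y)
  F′-steps n {X} = UnionIso-iterE inG-injective (λ a → inD≢inG (lab X a)) n F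

  H′-step : {W X : KGraph k} {Y : KGraph k′} →
            UnionIso inG inD W X Y → LabelIso inD (applyE H (X ⊔ W)) (applyE H′ Y)
  H′-step {W} {X} {Y} R =
    subst (LabelIso inD (applyE H (X ⊔ W))) (sym (applyE-++ (relabels inG inD) (mapE inD H) Y))
          (LabelIso-applyE inD-injective H merged)
    where
    Y₁ = applyE (relabels inG inD) Y
    merged : LabelIso inD (X ⊔ W) Y₁
    merged = UnionIso⇒LabelIso-⊔ (UnionIso-swap
               (UnionIso-cong (λ a → relabelsLab-hit inG-injective inD≢inG (lab W a))
                              (λ c → relabelsLab-miss inG inD (inD (lab X c)) (inD≢inG (lab X c)))
                 (UnionIso-∘ʳ R (relabels-≅ inG inD Y))))

  invariant-step : ∀ n {W D : KGraph k} {Y : KGraph k′} → iterE n F G₀ ≡ W → LabelIso inD D Y →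
                   LabelIso inD (applyE H (applyE L D ⊔ W)) (applyE H′ (iterE n F′ (applyE L′ Y)))
  invariant-step n refl R = H′-step (F′-steps n (L′-step R))

lemma5p9 : ∀ {k : ℕ} (G : ℕ → KGraph k) → IterativelyConstructible G →
           (H L : Elementary k) (D0 : KGraph k) →
           BiIterativelyConstructible (DSeq G H L D0)
lemma5p9 G (F , G-suc) H L D0 = k′ , mapLab inD D0 , H′ , F′ , L′ , LabelIso⇒UnderlyingIso ∘ invariant
  where
  open Construction (G 0) F H L
  iterE-G : ∀ n → iterE n F (G 0) ≡ G n
  iterE-G zero    = refl
  iterE-G (suc n) = trans (cong (applyE F) (iterE-G n)) (sym (G-suc n))
  invariant : ∀ n → LabelIso inD (DSeq G H L D0 n) (biSeq (mapLab inD D0) H′ F′ L′ n)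
  invariant zero    = mapLab-≅ inD D0
  invariant (suc n) = invariant-step n (iterE-G n) (invariant n)
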